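{- Let $G$ be a connected graph, and let $\mathcal{P}\subseteq\mathcal{L}(G)$ with $|\mathcal{P}|=3$. If there exists a path $P\in\mathcal{P}$ with $t_{\mathcal{P}}(P)=1$, then $f(G,\mathcal{P})=0$.
   Context: All graphs are finite and simple. For a connected graph $G$, $l(G)$ is the length (number of edges) of a longest path in $G$ and $\mathcal{L}(G)$ is the set of paths in $G$ with exactly $l(G)+1$ vertices. For $U\subseteq V(G)$, $d_G(x,U)=\min_{y\in U} d_G(x,y)$, and for $\mathcal{P}\subseteq\mathcal{L}(G)$, $f(G,\mathcal{P})=\min\{\sum_{P\in\mathcal{P}} d_G(v,V(P))\mid v\in V(G)\}$. For $X,Y\subseteq V(G)$, a path $Q$ with end-vertices $x,y$ (possibly $x=y$, in which case $Q$ is a single vertex) is an $X$-$Y$ path if $V(Q)\cap X=\{x\}$ and $V(Q)\cap Y=\{y\}$. For a set $\mathcal{P}$ of three paths and $P\in\mathcal{P}$ with $\mathcal{P}\setminus\{P\}=\{P_1,P_2\}$, $t_{\mathcal{P}}(P)$ is the number of $V(P_1)$-$V(P_2)$ paths that are subpaths of $P$. -}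

module Defs where

open import Data.Nat using (ℕ; zero; suc; _+_; _∸_; _≤_; _≤ᵇ_)
open import Data.Fin using (Fin; _≟_)
open import Data.Bool using (Bool; true; false; _∧_; not; if_then_else_)
open import Data.List using (List; []; _∷_; length; reverse; take; drop; upTo; concatMap; map; filterᵇ)
open import Data.Bool.ListAction using (any; all)
open import Data.List.Membership.Propositional using (_∈_)
open import Data.List.Relation.Unary.Unique.Propositional using (Unique)
open import Data.List.Relation.Unary.Linked using (Linked)
open import Data.Product using (Σ; ∃; _×_; _,_)
open import Data.Sum using (_⊎_)
open import Data.Empty using (⊥)
open import Relation.Nullary using (¬_; does)
open import Relation.Binary.PropositionalEquality using (_≡_)

record Graph : Set₁ where
  field
    n      : ℕ
    Adj    : Fin n → Fin n → Set
    adj-sym : ∀ {u v} → Adj u v → Adj v u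
    adj-irr : ∀ {u} → ¬ Adj u u

module _ (G : Graph) where
  open Graph G

  V : Set
  V = Fin n

  data Walk : V → V → ℕ → Set where
    here : ∀ {u} → Walk u u 0
    step : ∀ {u v w k} → Adj u v → Walk v w k → Walk u w (suc k)

  Connected : Set
  Connected = ∀ (u v : V) → ∃ λ k → Walk u v k

  IsPath : List V → Set
  IsPath []       = ⊥
  IsPath (v ∷ vs) = Unique (v ∷ vs) × Linked Adj (v ∷ vs)

  edges : List V → ℕ
  edges P = length P ∸ 1

  IsLongestPath : List V → Set
  IsLongestPath P = IsPath P × (∀ Q → IsPath Q → edges Q ≤ edges P)

  Dist : V → List V → ℕ → Set
  Dist x U k = (∃ λ u → u ∈ U × Walk x u k)
             × (∀ u j → u ∈ U → Walk x u j → k ≤ j)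

  SumDist : List V → List V → List V → V → ℕ → Set
  SumDist P₁ P₂ P₃ v s =
    ∃ λ k₁ → ∃ λ k₂ → ∃ λ k₃ →
      Dist v P₁ k₁ × Dist v P₂ k₂ × Dist v P₃ k₃ × s ≡ k₁ + k₂ + k₃

  FValue : List V → List V → List V → ℕ → Set
  FValue P₁ P₂ P₃ m =
    (∃ λ v → SumDist P₁ P₂ P₃ v m)
    × (∀ v s → SumDist P₁ P₂ P₃ v s → m ≤ s)

  -- same path as a subgraph: equal vertex sequence up to reversal
  SamePath : List V → List V → Set
  SamePath P Q = P ≡ Q ⊎ P ≡ reverse Q

  elemᵇ : V → List V → Bool
  elemᵇ x U = any (λ y → does (x ≟ y)) U

  startsIn : List V → List V → Bool
  startsIn X []       = false
  startsIn X (q ∷ qs) = elemᵇ q X ∧ all (λ y → not (elemᵇ y X)) qs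

  isXY : List V → List V → List V → Bool
  isXY X Y Q = startsIn X Q ∧ startsIn Y (reverse Q)

  segment : List V → ℕ → ℕ → List V
  segment P i j =
    if i ≤ᵇ j then take (suc (j ∸ i)) (drop i P)
              else reverse (take (suc (i ∸ j)) (drop j P))

  indexPairs : ℕ → List (ℕ × ℕ)
  indexPairs m = concatMap (λ i → map (λ j → (i , j)) (upTo m)) (upTo m)

  -- t: number of V(P₁)-V(P₂) paths that are subpaths of P
  t : List V → List V → List V → ℕ
  t P P₁ P₂ = length (filterᵇ (λ { (i , j) → isXY P₁ P₂ (segment P i j) })
                              (indexPairs (length P)))

module Submission where

-- We show that P, X, Y have a common vertex v; then every distance
-- d(v, V(Pᵢ)) is 0, so f(G, {P₁,P₂,P₃}) = 0.
--
-- Suppose no vertex of P lies on both X and Y.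
--   * Half lemma: if P = C a S with a ∈ X and S disjoint from X, then
--     |S| ≤ |C|.  Grafting the two arms of X at a onto S gives two paths that
--     are no longer than P, so both arms of X are at most |C|; since X is no
--     longer than P, |S| ≤ |C|.  Reading P backwards, the first vertex of P on
--     X lies in the first half of P.
--   * Hence the first Y-vertex of P comes before the last X-vertex of P, and
--     symmetrically the first X-vertex before the last Y-vertex.
--   * Between a Y-vertex and a later X-vertex, P contains a block from Y to X
--     with no other vertex on X or Y, and vice versa.  These two blocks are
--     counted by t as index pairs (i , j) with i < j and with j < i
--     respectively, so t ≥ 2.
-- The file develops list facts, first/last occurrences and crossings
-- (generic), then paths in G, then the count t, and finally the theorem.

open import Defs
open import Data.Product using (_×_)
open import Data.Sum using (_⊎_)
open import Data.List using (List)
open import Relation.Nullary using (¬_)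
open import Relation.Binary.PropositionalEquality using (_≡_)

open import Data.Bool using (Bool; true; false; T; not)
open import Data.Bool.Properties using (T-∧)
open import Data.Empty using (⊥-elim)
import Data.Fin as Fin
open import Data.List using ([]; _∷_; _++_; [_]; length; reverse; take; drop; upTo; filterᵇ)
import Data.List
open import Data.List.Properties
  using (∷-injectiveˡ; ∷-injectiveʳ; ++-assoc; length-++; length-++-sucʳ; length-++-≤ˡ; ++-identityʳ;
         unfold-reverse; reverse-++; reverse-involutive; length-reverse; take++drop≡id)
open import Data.List.Membership.Propositional using (_∈_; _∉_; find; lose)
open import Data.List.Membership.Propositional.Properties
  using (∈-++⁺ˡ; ∈-++⁺ʳ; ∈-∃++; ∈-concatMap⁺; ∈-map⁺; ∈-upTo⁺; ∈-filter⁺; ∈-filter⁻)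
open import Data.List.Relation.Binary.Disjoint.Propositional using (Disjoint)
open import Data.List.Relation.Binary.Permutation.Propositional using (↭-sym; ↭⇒↭ₛ)
open import Data.List.Relation.Binary.Permutation.Propositional.Properties using (↭-reverse)
open import Data.List.Relation.Binary.Permutation.Setoid.Properties using (Unique-resp-↭)
open import Data.List.Relation.Binary.Subset.Propositional using (_⊆_)
open import Data.List.Relation.Binary.Subset.Propositional.Properties using (⊆-reflexive)
open import Data.List.Relation.Unary.All as All using (All; []; _∷_)
open import Data.List.Relation.Unary.All.Properties using (anti-mono; all⁻; ¬Any⇒All¬)
  renaming (++⁺ to All-++⁺; ++⁻ˡ to All-++⁻ˡ; ++⁻ʳ to All-++⁻ʳ)
open import Data.List.Relation.Unary.Any as Any using (here; there; any?)
open import Data.List.Relation.Unary.Any.Properties using (reverse⁻)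
open import Data.List.Relation.Unary.AllPairs using ([]; _∷_)
open import Data.List.Relation.Unary.Linked using (Linked; []; [-]; _∷_)
open import Data.List.Relation.Unary.Unique.Propositional using (Unique)
import Data.List.Relation.Unary.Unique.Propositional.Properties as Unique
open import Data.Nat using (ℕ; suc; _+_; _∸_; _≤_; _<_; _≤ᵇ_; z≤n; s≤s; z<s)
open import Data.Nat.Properties
  using (≤-refl; ≤-trans; ≤-pred; ≤ᵇ⇒≤; ≤⇒≤ᵇ; <⇒≱; ≮⇒≥; <-asym; <-trans; suc-injective;
         m≤m+n; m+n∸m≡n; +-identityʳ; +-mono-≤; +-mono-<; +-monoʳ-≤; +-monoʳ-<;
         +-cancelˡ-≤; +-cancelʳ-≤; module ≤-Reasoning)
open import Data.Product using (∃-syntax; _,_; proj₁; proj₂)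
open import Data.Sum using (inj₁; inj₂)
open import Data.Unit using (tt)
open import Function using (_∘_; Equivalence)
open import Relation.Binary.Definitions using (DecidableEquality; Symmetric)
open import Relation.Binary.PropositionalEquality
  using (_≢_; refl; sym; trans; cong; cong₂; subst; subst₂; setoid; module ≡-Reasoning)
open import Relation.Nullary using (yes; no)
open import Relation.Nullary.Decidable.Core using (T?)
open import Relation.Nullary.Decidable using (_×-dec_)

module _ {A : Set} where

  _avoids_ : List A → List A → Set
  L avoids U = All (_∉ U) L

  avoids-⊆ : ∀ {L U U′} → U′ ⊆ U → L avoids U → L avoids U′
  avoids-⊆ U′⊆U = All.map (λ v∉U → v∉U ∘ U′⊆U)

  reverse-split : ∀ C (a : A) S → reverse (C ++ a ∷ S) ≡ reverse S ++ a ∷ reverse C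
  reverse-split C a S = begin
    reverse (C ++ a ∷ S)              ≡⟨ reverse-++ C (a ∷ S) ⟩
    reverse (a ∷ S) ++ reverse C      ≡⟨ cong (_++ reverse C) (unfold-reverse a S) ⟩
    (reverse S ++ [ a ]) ++ reverse C ≡⟨ ++-assoc (reverse S) [ a ] (reverse C) ⟩
    reverse S ++ a ∷ reverse C        ∎
    where open ≡-Reasoning

  length-split : ∀ C (a : A) S → length (C ++ a ∷ S) ≡ suc (length C + length S)
  length-split C a S = trans (length-++-sucʳ C a S) (cong suc (length-++ C))

  split-balance : ∀ C (a : A) S C′ b S′ → C ++ a ∷ S ≡ C′ ++ b ∷ S′ →
                  length C + length S ≡ length C′ + length S′
  split-balance C a S C′ b S′ eq =
    suc-injective (trans (sym (length-split C a S)) (trans (cong length eq) (length-split C′ b S′)))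

  pivot-order : ∀ C (a : A) S C′ b S′ → C ++ a ∷ S ≡ C′ ++ b ∷ S′ →
                length C′ ≤ length C → a ≡ b ⊎ a ∈ S′
  pivot-order []      a S []        b S′ eq z≤n      = inj₁ (∷-injectiveˡ eq)
  pivot-order (c ∷ C) a S []        b S′ eq z≤n      =
    inj₂ (subst (a ∈_) (∷-injectiveʳ eq) (∈-++⁺ʳ C (here refl)))
  pivot-order (c ∷ C) a S (c′ ∷ C′) b S′ eq (s≤s le) =
    pivot-order C a S C′ b S′ (∷-injectiveʳ eq) le

  drop-length-++ : ∀ (P : List A) {L} → drop (length P) (P ++ L) ≡ L
  drop-length-++ []      = refl
  drop-length-++ (_ ∷ P) = drop-length-++ P

  take-length-++ : ∀ (Q : List A) {L} → take (length Q) (Q ++ L) ≡ Q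
  take-length-++ []      = refl
  take-length-++ (x ∷ Q) = cong (x ∷_) (take-length-++ Q)

  take-⊆ : ∀ n (L : List A) → take n L ⊆ L
  take-⊆ n L = ⊆-reflexive (take++drop≡id n L) ∘ ∈-++⁺ˡ

  drop-⊆ : ∀ n (L : List A) → drop n L ⊆ L
  drop-⊆ n L = ⊆-reflexive (take++drop≡id n L) ∘ ∈-++⁺ʳ (take n L)

  single-member : ∀ {L : List A} → length L ≡ 1 → ∃[ x ] (x ∈ L)
  single-member {x ∷ []} _ = x , here refl

  single-unique : ∀ {L : List A} {x y} → length L ≡ 1 → x ∈ L → y ∈ L → x ≡ y
  single-unique {_ ∷ []} _ (here refl) (here refl) = refl

  unique-prefix : ∀ xs {ys : List A} → Unique (xs ++ ys) → Unique xs
  unique-prefix []       _        = []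
  unique-prefix (x ∷ xs) (px ∷ u) = All-++⁻ˡ xs px ∷ unique-prefix xs u

  unique-suffix : ∀ xs {ys : List A} → Unique (xs ++ ys) → Unique ys
  unique-suffix []       u       = u
  unique-suffix (x ∷ xs) (_ ∷ u) = unique-suffix xs u

  unique-disjoint : ∀ xs {ys : List A} → Unique (xs ++ ys) → Disjoint xs ys
  unique-disjoint (x ∷ xs) (px ∷ _) (here refl , q) = All.lookup px (∈-++⁺ʳ xs q) refl
  unique-disjoint (x ∷ xs) (_ ∷ u)  (there p , q)   = unique-disjoint xs u (p , q)

  unique-reverse : ∀ {xs : List A} → Unique xs → Unique (reverse xs)
  unique-reverse {xs} = Unique-resp-↭ (setoid A) (↭⇒↭ₛ (↭-sym (↭-reverse xs)))

  module _ {R : A → A → Set} where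

    linked-prefix : ∀ xs {a ys} → Linked R (xs ++ a ∷ ys) → Linked R (xs ++ [ a ])
    linked-prefix []           _       = [-]
    linked-prefix (x ∷ [])     (r ∷ _) = r ∷ [-]
    linked-prefix (x ∷ y ∷ xs) (r ∷ l) = r ∷ linked-prefix (y ∷ xs) l

    linked-suffix : ∀ xs {a ys} → Linked R (xs ++ a ∷ ys) → Linked R (a ∷ ys)
    linked-suffix []           l       = l
    linked-suffix (x ∷ [])     (_ ∷ l) = l
    linked-suffix (x ∷ y ∷ xs) (_ ∷ l) = linked-suffix (y ∷ xs) l

    linked-join : ∀ xs {a ys} → Linked R (xs ++ [ a ]) → Linked R (a ∷ ys) →
                  Linked R (xs ++ a ∷ ys)
    linked-join []           _       l = l
    linked-join (x ∷ [])     (r ∷ _) l = r ∷ l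
    linked-join (x ∷ y ∷ xs) (r ∷ k) l = r ∷ linked-join (y ∷ xs) k l

    linked-reverse : Symmetric R → ∀ {xs} → Linked R xs → Linked R (reverse xs)
    linked-reverse R-sym {[]}         _       = []
    linked-reverse R-sym {x ∷ []}     _       = [-]
    linked-reverse R-sym {x ∷ y ∷ xs} (r ∷ l) =
      subst (Linked R) (sym (reverse-split [ x ] y xs))
        (linked-join (reverse xs)
          (subst (Linked R) (reverse-split [] y xs) (linked-reverse R-sym l))
          (R-sym r ∷ [-]))

module Occurrences {A : Set} (_≟_ : DecidableEquality A) where

  open import Data.List.Membership.DecPropositional _≟_ using (_∈?_)

  FirstIn : List A → List A → Set
  FirstIn U L = ∃[ C ] ∃[ a ] ∃[ S ] (L ≡ C ++ a ∷ S × a ∈ U × C avoids U)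

  LastIn : List A → List A → Set
  LastIn U L = ∃[ C ] ∃[ a ] ∃[ S ] (L ≡ C ++ a ∷ S × a ∈ U × S avoids U)

  first-in : ∀ U {L x} → x ∈ L → x ∈ U → FirstIn U L
  first-in U {y ∷ L} x∈L x∈U with y ∈? U | x∈L
  ... | yes y∈U | _          = [] , y , L , refl , y∈U , []
  ... | no  y∉U | here refl  = ⊥-elim (y∉U x∈U)
  ... | no  y∉U | there x∈L′ with first-in U x∈L′ x∈U
  ...   | C , a , S , refl , a∈U , C-avoids = y ∷ C , a , S , refl , a∈U , y∉U ∷ C-avoids

  last-in : ∀ U {L x} → x ∈ L → x ∈ U → LastIn U L
  last-in U {y ∷ L} x∈L x∈U with any? (_∈? U) L | x∈L
  ... | yes later | _ with find later
  ...   | z , z∈L , z∈U with last-in U z∈L z∈U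
  ...     | C , a , S , refl , a∈U , S-avoids = y ∷ C , a , S , refl , a∈U , S-avoids
  last-in U {y ∷ L} x∈L x∈U | no none | here refl  = [] , y , L , refl , x∈U , ¬Any⇒All¬ L none
  last-in U {y ∷ L} x∈L x∈U | no none | there x∈L′ = ⊥-elim (none (lose x∈L′ x∈U))

  NoCommon : List A → List A → List A → Set
  NoCommon L U W = ∀ {v} → v ∈ L → v ∈ U → v ∉ W

  no-common-swap : ∀ {L U W} → NoCommon L U W → NoCommon L W U
  no-common-swap no-common v∈L v∈W v∈U = no-common v∈L v∈U v∈W

  Precedes : List A → List A → List A → Set
  Precedes U W L = ∃[ C ] ∃[ u ] ∃[ B ] (L ≡ C ++ u ∷ B × u ∈ U × ∃[ x ] (x ∈ B × x ∈ W))

  record Crossing (U W L : List A) : Set where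
    field
      pre   : List A
      u     : A
      mid   : List A
      w     : A
      post  : List A
      split : L ≡ pre ++ u ∷ mid ++ w ∷ post
      u∈U   : u ∈ U
      w∈W   : w ∈ W
      tail-avoids : (mid ++ [ w ]) avoids U
      init-avoids : (u ∷ mid) avoids W

  -- Between an element of U and a later element of W there is a crossing:
  -- from the first W-element w after u, go back to the last U-element before w.
  crossing : ∀ {U W L} → NoCommon L U W → Precedes U W L → Crossing U W L
  crossing {U} {W} no-common (C , y , B , refl , y∈U , x , x∈B , x∈W)
    with first-in W x∈B x∈W
  ... | D , w , E , refl , w∈W , D-avoids
    with last-in U {y ∷ D} (here refl) y∈U
  ... | F , u , G , yD≡FuG , u∈U , G-avoids = record
    { pre = C ++ F ; u = u ; mid = G ; w = w ; post = E
    ; split = split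
    ; u∈U = u∈U ; w∈W = w∈W
    ; tail-avoids = All-++⁺ G-avoids (w∉U ∷ [])
    ; init-avoids = All-++⁻ʳ F (subst (_avoids W) yD≡FuG (y∉W ∷ D-avoids))
    }
    where
    open ≡-Reasoning
    w∉U : w ∉ U
    w∉U w∈U = no-common (∈-++⁺ʳ C (there (∈-++⁺ʳ D (here refl)))) w∈U w∈W
    y∉W : y ∉ W
    y∉W = no-common (∈-++⁺ʳ C (here refl)) y∈U
    split : C ++ (y ∷ D) ++ w ∷ E ≡ (C ++ F) ++ u ∷ G ++ w ∷ E
    split = begin
      C ++ (y ∷ D) ++ w ∷ E     ≡⟨ cong (λ Z → C ++ Z ++ w ∷ E) yD≡FuG ⟩
      C ++ (F ++ u ∷ G) ++ w ∷ E ≡⟨ cong (C ++_) (++-assoc F (u ∷ G) (w ∷ E)) ⟩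
      C ++ F ++ u ∷ G ++ w ∷ E  ≡⟨ ++-assoc C F (u ∷ G ++ w ∷ E) ⟨
      (C ++ F) ++ u ∷ G ++ w ∷ E ∎

-- Arithmetic of the half lemma: if both arms x₀, x₁ of X are at most c and
-- P (with c + s non-pivot vertices) is no longer than X, then s ≤ c.
arms-bound : ∀ {x₀ x₁ c s} → x₀ ≤ c → x₁ ≤ c → c + s ≤ x₀ + x₁ → s ≤ c
arms-bound {x₀} {x₁} {c} {s} x₀≤c x₁≤c le =
  +-cancelˡ-≤ c s c (≤-trans le (+-mono-≤ x₀≤c x₁≤c))

balanced : ∀ {c s c′ s′} → s ≤ c → c′ ≤ s′ → c + s ≡ c′ + s′ → c′ ≤ c
balanced {c} {s} {c′} {s′} s≤c c′≤s′ eq = ≮⇒≥ λ c<c′ → <⇒≱ (+-mono-< c<c′ c<c′) (begin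
  c′ + c′ ≤⟨ +-monoʳ-≤ c′ c′≤s′ ⟩
  c′ + s′ ≡⟨ eq ⟨
  c + s   ≤⟨ +-monoʳ-≤ c s≤c ⟩
  c + c   ∎)
  where open ≤-Reasoning

module _ (G : Graph) where
  open Graph G
  open Occurrences (Fin._≟_ {n})
  open import Data.List.Membership.DecPropositional (Fin._≟_ {n}) using (_∈?_)

  path⇒ : ∀ {L} → IsPath G L → Unique L × Linked Adj L
  path⇒ {_ ∷ _} p = p

  path⇐ : ∀ A {a B} → Unique (A ++ a ∷ B) → Linked Adj (A ++ a ∷ B) → IsPath G (A ++ a ∷ B)
  path⇐ []      u l = u , l
  path⇐ (_ ∷ _) u l = u , l

  reverse-path : ∀ {L} → IsPath G L → IsPath G (reverse L)
  reverse-path {x ∷ L} (u , l) =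
    subst (IsPath G) (sym split)
      (path⇐ (reverse L) (subst Unique split (unique-reverse u))
                         (subst (Linked Adj) split (linked-reverse adj-sym l)))
    where split = reverse-split [] x L

  reverse-longest : ∀ {L} → IsLongestPath G L → IsLongestPath G (reverse L)
  reverse-longest {L} (p , longest) =
    reverse-path p , λ Q q → subst (λ k → edges G Q ≤ k ∸ 1) (sym (length-reverse L)) (longest Q q)

  length-bound : ∀ {P Q} → IsLongestPath G P → IsPath G Q → length Q ≤ length P
  length-bound {_ ∷ _} {_ ∷ _} (_ , longest) q = s≤s (longest _ q)

  graft : ∀ A {a} B C D → IsPath G (A ++ a ∷ B) → IsPath G (C ++ a ∷ D) → D avoids A →
          IsPath G (A ++ a ∷ D)
  graft A {a} B C D p q D-avoids with path⇒ p | path⇒ q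
  ... | u₁ , l₁ | u₂ , l₂ =
    path⇐ A (Unique.++⁺ (unique-prefix A u₁) (unique-suffix C u₂) disjoint)
            (linked-join A (linked-prefix A l₁) (linked-suffix C l₂))
    where
    disjoint : Disjoint A (a ∷ D)
    disjoint (v∈A , here refl)  = unique-disjoint A u₁ (v∈A , here refl)
    disjoint (v∈A , there v∈D) = All.lookup D-avoids v∈D v∈A

  -- For a longest path P = C ++ a ∷ S, an arm A of a path through a that S
  -- avoids is no longer than C: otherwise A ++ a ∷ S would be longer than P.
  arm-bound : ∀ {P} C {a} S A B → IsLongestPath G P → P ≡ C ++ a ∷ S →
              IsPath G (A ++ a ∷ B) → S avoids A → length A ≤ length C
  arm-bound C {a} S A B longest refl q S-avoids =
    +-cancelʳ-≤ (length S) (length A) (length C) (≤-pred (subst₂ _≤_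
      (length-split A a S) (length-split C a S)
      (length-bound longest (graft A B C S q (proj₁ longest) S-avoids))))

  last-bound : ∀ {P X} C {a} S → IsLongestPath G P → IsLongestPath G X →
               P ≡ C ++ a ∷ S → a ∈ X → S avoids X → length S ≤ length C
  last-bound C {a} S lp lx P≡CaS a∈X S-avoids with ∈-∃++ a∈X
  ... | X₀ , X₁ , refl = arms-bound front back (≤-pred (subst₂ _≤_
      (trans (cong length P≡CaS) (length-split C a S)) (length-split X₀ a X₁)
      (length-bound lx (proj₁ lp))))
    where
    front : length X₀ ≤ length C
    front = arm-bound C S X₀ X₁ lp P≡CaS (proj₁ lx) (avoids-⊆ ∈-++⁺ˡ S-avoids)
    back : length X₁ ≤ length C
    back = subst (_≤ length C) (length-reverse X₁)
      (arm-bound C S (reverse X₁) (reverse X₀) lp P≡CaS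
        (subst (IsPath G) (reverse-split X₀ a X₁) (reverse-path (proj₁ lx)))
        (avoids-⊆ (∈-++⁺ʳ X₀ ∘ there ∘ reverse⁻) S-avoids))

  first-bound : ∀ {P X} C {a} S → IsLongestPath G P → IsLongestPath G X →
                P ≡ C ++ a ∷ S → a ∈ X → C avoids X → length C ≤ length S
  first-bound C {a} S lp lx refl a∈X C-avoids =
    subst₂ _≤_ (length-reverse C) (length-reverse S)
      (last-bound (reverse S) (reverse C) (reverse-longest lp) lx
        (reverse-split C a S) a∈X (anti-mono reverse⁻ C-avoids))

  y-before-x : ∀ {P X Y x y} → IsLongestPath G P → IsLongestPath G X → IsLongestPath G Y →
               NoCommon P X Y → x ∈ P → x ∈ X → y ∈ P → y ∈ Y → Precedes Y X P
  y-before-x lp lx ly no-common x∈P x∈X y∈P y∈Y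
    with last-in _ x∈P x∈X | first-in _ y∈P y∈Y
  ... | C , a , S , P≡CaS , a∈X , S-avoids | C′ , b , S′ , P≡C′bS′ , b∈Y , C′-avoids
    with pivot-order C a S C′ b S′ (trans (sym P≡CaS) P≡C′bS′) b-not-later
    where
    b-not-later : length C′ ≤ length C
    b-not-later = balanced (last-bound C S lp lx P≡CaS a∈X S-avoids)
                           (first-bound C′ S′ lp ly P≡C′bS′ b∈Y C′-avoids)
                           (split-balance C a S C′ b S′ (trans (sym P≡CaS) P≡C′bS′))
  ... | inj₁ refl = ⊥-elim (no-common (subst (a ∈_) (sym P≡CaS) (∈-++⁺ʳ C (here refl))) a∈X b∈Y)
  ... | inj₂ a∈S′ = C′ , b , S′ , P≡C′bS′ , b∈Y , a , a∈S′ , a∈X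

  elemᵇ-sound : ∀ {x} U → T (elemᵇ G x U) → x ∈ U
  elemᵇ-sound {x} (y ∷ U) h with x Fin.≟ y
  ... | yes x≡y = here x≡y
  ... | no  _   = there (elemᵇ-sound U h)

  elemᵇ-complete : ∀ {x U} → x ∈ U → T (elemᵇ G x U)
  elemᵇ-complete {x} {y ∷ U} x∈U with x Fin.≟ y | x∈U
  ... | yes _   | _          = tt
  ... | no  x≢y | here x≡y   = ⊥-elim (x≢y x≡y)
  ... | no  _   | there x∈U′ = elemᵇ-complete x∈U′

  elemᵇ-absent : ∀ {x} U → x ∉ U → T (not (elemᵇ G x U))
  elemᵇ-absent {x} U x∉U with elemᵇ G x U in eq
  ... | false = tt
  ... | true  = x∉U (elemᵇ-sound U (subst T (sym eq) tt))

  startsIn-intro : ∀ {X q Q} → q ∈ X → Q avoids X → T (startsIn G X (q ∷ Q))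
  startsIn-intro q∈X Q-avoids =
    Equivalence.from T-∧ (elemᵇ-complete q∈X , all⁻ _ (All.map (elemᵇ-absent _) Q-avoids))

  startsIn-head : ∀ X Q → T (startsIn G X Q) → ∃[ q ] (q ∈ Q × q ∈ X)
  startsIn-head X (q ∷ Q) h = q , here refl , elemᵇ-sound X (proj₁ (Equivalence.to T-∧ h))

  crossing-isXY : ∀ {X Y u M w} → u ∈ X → w ∈ Y → (M ++ [ w ]) avoids X → (u ∷ M) avoids Y →
                  T (isXY G X Y (u ∷ M ++ [ w ]))
  crossing-isXY {Y = Y} {u} {M} {w} u∈X w∈Y tail-avoids init-avoids =
    Equivalence.from T-∧
      ( startsIn-intro u∈X tail-avoids
      , subst (T ∘ startsIn G Y) (sym (reverse-split (u ∷ M) w []))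
          (startsIn-intro w∈Y (anti-mono reverse⁻ init-avoids)))

  isXY-reverse : ∀ X Y Q → T (isXY G Y X Q) → T (isXY G X Y (reverse Q))
  isXY-reverse X Y Q h with Equivalence.to T-∧ h
  ... | starts-Y , ends-X =
    Equivalence.from T-∧ (ends-X , subst (T ∘ startsIn G Y) (sym (reverse-involutive Q)) starts-Y)

  segment-forward : ∀ P {i j} → i ≤ j → segment G P i j ≡ take (suc (j ∸ i)) (drop i P)
  segment-forward P {i} {j} i≤j with i ≤ᵇ j | ≤⇒≤ᵇ i≤j
  ... | true | _ = refl

  segment-backward : ∀ P {i j} → j < i → segment G P i j ≡ reverse (take (suc (i ∸ j)) (drop j P))
  segment-backward P {i} {j} j<i with i ≤ᵇ j | ≤ᵇ⇒≤ i j
  ... | false | _   = refl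
  ... | true  | i≤j = ⊥-elim (<⇒≱ j<i (i≤j tt))

  segment-⊆ : ∀ P i j → segment G P i j ⊆ P
  segment-⊆ P i j with i ≤ᵇ j
  ... | true  = drop-⊆ i P ∘ take-⊆ (suc (j ∸ i)) (drop i P)
  ... | false = drop-⊆ j P ∘ take-⊆ (suc (i ∸ j)) (drop j P) ∘ reverse⁻

  xyTest : List (V G) → List (V G) → List (V G) → ℕ × ℕ → Bool
  xyTest P X Y (i , j) = isXY G X Y (segment G P i j)

  xyPairs : List (V G) → List (V G) → List (V G) → List (ℕ × ℕ)
  xyPairs P X Y = filterᵇ (xyTest P X Y) (indexPairs G (length P))

  counted : ∀ {P X Y i j} → i < length P → j < length P → T (isXY G X Y (segment G P i j)) →
            (i , j) ∈ xyPairs P X Y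
  counted {P} {X} {Y} {i} {j} i<m j<m h = ∈-filter⁺ (T? ∘ xyTest P X Y) pair∈ h
    where
    pair∈ : (i , j) ∈ indexPairs G (length P)
    pair∈ = ∈-concatMap⁺ (λ i′ → Data.List.map (i′ ,_) (upTo (length P)))
              (Any.map (λ { refl → ∈-map⁺ (i ,_) (∈-upTo⁺ j<m) }) (∈-upTo⁺ i<m))

  count-meets : ∀ {P X Y i j} → (i , j) ∈ xyPairs P X Y →
                (∃[ x ] (x ∈ P × x ∈ X)) × (∃[ y ] (y ∈ P × y ∈ Y))
  count-meets {P} {X} {Y} {i} {j} p
    with Equivalence.to T-∧ (proj₂ (∈-filter⁻ (T? ∘ xyTest P X Y) {xs = indexPairs G (length P)} p))
  ... | starts-X , ends-Y with startsIn-head X _ starts-X | startsIn-head Y _ ends-Y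
  ... | x , x∈seg , x∈X | y , y∈rev , y∈Y =
    (x , segment-⊆ P i j x∈seg , x∈X) , (y , segment-⊆ P i j (reverse⁻ y∈rev) , y∈Y)

  module Block (A Q B : List (V G)) (k : ℕ) (|Q| : length Q ≡ suc (suc k)) where

    a = length A
    b = length A + suc k

    span : take (suc (b ∸ a)) (drop a (A ++ Q ++ B)) ≡ Q
    span = begin
      take (suc (b ∸ a)) (drop a (A ++ Q ++ B))
        ≡⟨ cong₂ (λ m → take (suc m)) (m+n∸m≡n a (suc k)) (drop-length-++ A) ⟩
      take (suc (suc k)) (Q ++ B)               ≡⟨ cong (λ m → take m (Q ++ B)) |Q| ⟨
      take (length Q) (Q ++ B)                  ≡⟨ take-length-++ Q ⟩
      Q                                         ∎
      where open ≡-Reasoning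

    a<b : a < b
    a<b = subst (_< b) (+-identityʳ a) (+-monoʳ-< a z<s)

    b<|P| : b < length (A ++ Q ++ B)
    b<|P| = begin-strict
      a + suc k            <⟨ +-monoʳ-< a ≤-refl ⟩
      a + suc (suc k)      ≡⟨ cong (a +_) |Q| ⟨
      a + length Q         ≤⟨ +-monoʳ-≤ a (length-++-≤ˡ Q) ⟩
      a + length (Q ++ B)  ≡⟨ length-++ A ⟨
      length (A ++ Q ++ B) ∎
      where open ≤-Reasoning

    forward : segment G (A ++ Q ++ B) a b ≡ Q
    forward = trans (segment-forward _ (m≤m+n a (suc k))) span

    backward : segment G (A ++ Q ++ B) b a ≡ reverse Q
    backward = trans (segment-backward _ a<b) (cong reverse span)

  crossing-block : ∀ {P U W} → Crossing U W P →
    ∃[ A ] ∃[ Q ] ∃[ B ] ∃[ k ] (P ≡ A ++ Q ++ B × length Q ≡ suc (suc k) × T (isXY G U W Q))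
  crossing-block c =
    pre , u ∷ mid ++ [ w ] , post , length mid ,
    trans split (cong (λ Z → pre ++ u ∷ Z) (sym (++-assoc mid [ w ] post))) ,
    cong suc (trans (length-++-sucʳ mid w []) (cong (suc ∘ length) (++-identityʳ mid))) ,
    crossing-isXY u∈U w∈W tail-avoids init-avoids
    where open Crossing c

  forward-pair : ∀ {P X Y} → Crossing X Y P → ∃[ i ] ∃[ j ] ((i , j) ∈ xyPairs P X Y × i < j)
  forward-pair {X = X} {Y} c with crossing-block c
  ... | A , Q , B , k , refl , |Q| , is-XY =
    a , b , counted (<-trans a<b b<|P|) b<|P| (subst (T ∘ isXY G X Y) (sym forward) is-XY) , a<b
    where open Block A Q B k |Q|

  backward-pair : ∀ {P X Y} → Crossing Y X P → ∃[ i ] ∃[ j ] ((i , j) ∈ xyPairs P X Y × j < i)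
  backward-pair {X = X} {Y} c with crossing-block c
  ... | A , Q , B , k , refl , |Q| , is-YX =
    b , a , counted b<|P| (<-trans a<b b<|P|)
              (subst (T ∘ isXY G X Y) (sym backward) (isXY-reverse X Y Q is-YX)) , a<b
    where open Block A Q B k |Q|

  -- Without a vertex common to P, X and Y, P has an X-Y crossing and a Y-X
  -- crossing, which t counts as two different pairs.
  no-common⇒t≢1 : ∀ {P X Y} → IsLongestPath G P → IsLongestPath G X → IsLongestPath G Y →
                  NoCommon P X Y → t G P X Y ≢ 1
  no-common⇒t≢1 lp lx ly no-common t≡1 with count-meets (proj₂ (single-member t≡1))
  ... | (x , x∈P , x∈X) , (y , y∈P , y∈Y)
    with forward-pair (crossing no-common
                        (y-before-x lp ly lx (no-common-swap no-common) y∈P y∈Y x∈P x∈X))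
       | backward-pair (crossing (no-common-swap no-common)
                        (y-before-x lp lx ly no-common x∈P x∈X y∈P y∈Y))
  ... | i , j , fwd , i<j | i′ , j′ , bwd , j′<i′ = opposite (single-unique t≡1 fwd bwd)
    where
    opposite : (i , j) ≢ (i′ , j′)
    opposite refl = <-asym i<j j′<i′

  common-vertex : ∀ {P X Y} → IsLongestPath G P → IsLongestPath G X → IsLongestPath G Y →
                  t G P X Y ≡ 1 → ∃[ v ] (v ∈ P × v ∈ X × v ∈ Y)
  common-vertex {P} {X} {Y} lp lx ly t≡1 with any? (λ v → (v ∈? X) ×-dec (v ∈? Y)) P
  ... | yes shared = find shared
  ... | no  none   =
    ⊥-elim (no-common⇒t≢1 lp lx ly (λ v∈P v∈X v∈Y → none (lose v∈P (v∈X , v∈Y))) t≡1)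

  f-zero : ∀ {P₁ P₂ P₃ v} → v ∈ P₁ → v ∈ P₂ → v ∈ P₃ → FValue G P₁ P₂ P₃ 0
  f-zero {v = v} v∈P₁ v∈P₂ v∈P₃ =
    (v , 0 , 0 , 0 , on v∈P₁ , on v∈P₂ , on v∈P₃ , refl) , λ _ _ _ → z≤n
    where
    on : ∀ {P} → v ∈ P → Dist G v P 0
    on v∈P = (v , v∈P , here) , λ _ _ _ _ → z≤n

lemma2p3 : (G : Graph) → Connected G →
    (P₁ P₂ P₃ : List (V G)) →
    IsLongestPath G P₁ → IsLongestPath G P₂ → IsLongestPath G P₃ →
    ¬ SamePath G P₁ P₂ → ¬ SamePath G P₁ P₃ → ¬ SamePath G P₂ P₃ →
    (t G P₁ P₂ P₃ ≡ 1 ⊎ t G P₂ P₁ P₃ ≡ 1 ⊎ t G P₃ P₁ P₂ ≡ 1) →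
    FValue G P₁ P₂ P₃ 0
lemma2p3 G _ P₁ P₂ P₃ l₁ l₂ l₃ _ _ _ (inj₁ t₁≡1) with common-vertex G l₁ l₂ l₃ t₁≡1
... | v , v∈P₁ , v∈P₂ , v∈P₃ = f-zero G v∈P₁ v∈P₂ v∈P₃
lemma2p3 G _ P₁ P₂ P₃ l₁ l₂ l₃ _ _ _ (inj₂ (inj₁ t₂≡1)) with common-vertex G l₂ l₁ l₃ t₂≡1
... | v , v∈P₂ , v∈P₁ , v∈P₃ = f-zero G v∈P₁ v∈P₂ v∈P₃
lemma2p3 G _ P₁ P₂ P₃ l₁ l₂ l₃ _ _ _ (inj₂ (inj₂ t₃≡1)) with common-vertex G l₃ l₁ l₂ t₃≡1
... | v , v∈P₃ , v∈P₁ , v∈P₂ = f-zero G v∈P₁ v∈P₂ v∈P₃
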